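{- For $n\ge1$ let $c_{desc}(n)$ be as defined in the context. Then for every integer $m\ge1$, $$c_{desc}(2m)=2c_{desc}(m),\qquad c_{desc}(2m+1)=2c_{desc}(m)-\omega(m)+2^{\rho_2},$$ where $\omega(m)$ is the number of $1$s in the binary expansion of $m$ and $\rho_2$ is the position of the second least significant $1$ bit of $n=2m+1$.
   Context: Write $n=\sum_{i=1}^{\omega(n)}2^{\rho_i}$ with $\rho_{\omega(n)}>\dots>\rho_1\ge0$. A full binary tree is a rooted tree in which every node has $0$ or $2$ children; a ladder tree is one in which every internal node has at least one leaf child. A perfect binary tree with $2^j$ leaves has all its leaves at depth $j$. The descending MinD tree on $n$ leaves is obtained from the ladder tree with $\omega(n)$ leaves by replacing its leaves with perfect trees so that the perfect tree with $2^{\rho_{\omega(n)}}$ leaves is a child of the root, the perfect tree with $2^{\rho_{\omega(n)-1}}$ leaves is on the next rung down, and so on, with the perfect trees with $2^{\rho_2}$ and $2^{\rho_1}$ leaves as the two children of the lowest internal node of the ladder (if $\omega(n)=1$ it is just the perfect tree with $n$ leaves). $c_{desc}(n)$ is its Colless index, where the Colless index of a full binary tree is $\sum|\ell_L(v)-\ell_R(v)|$ over internal nodes $v$, with $\ell_L(v),\ell_R(v)$ the numbers of leaves in the left and right subtrees of $v$. -}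

module Defs where

open import Data.Nat using (ℕ; zero; suc; _+_; _*_; _^_; ∣_-_∣; _/_; _%_; _≟_)
open import Data.List using (List; []; _∷_; reverse; length)
open import Relation.Nullary using (yes; no)

data Tree : Set where
  leaf : Tree
  node : Tree → Tree → Tree

leaves : Tree → ℕ
leaves leaf = 1
leaves (node l r) = leaves l + leaves r

colless : Tree → ℕ
colless leaf = 0
colless (node l r) = ∣ leaves l - leaves r ∣ + colless l + colless r

perfect : ℕ → Tree
perfect zero = leaf
perfect (suc j) = node (perfect j) (perfect j)

-- Positions of the 1 bits of n, in increasing order (ρ_1 < ρ_2 < ...).
-- expsAux fuel k n : positions (offset by k) of the 1-bits of n; fuel ≥ n suffices.
expsAux : ℕ → ℕ → ℕ → List ℕ
expsAux zero k n = []
expsAux (suc f) k n with n ≟ 0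
... | yes _ = []
... | no _ with n % 2 ≟ 1
...   | yes _ = k ∷ expsAux f (suc k) (n / 2)
...   | no _ = expsAux f (suc k) (n / 2)

exps : ℕ → List ℕ
exps n = expsAux n 0 n

ω : ℕ → ℕ
ω n = length (exps n)

-- ρ_i(n) (1-indexed, from the least significant bit); default 0 if i is out of range
nth1 : List ℕ → ℕ → ℕ
nth1 [] _ = 0
nth1 (x ∷ xs) zero = 0
nth1 (x ∷ xs) (suc zero) = x
nth1 (x ∷ xs) (suc (suc i)) = nth1 xs (suc i)

ρ : ℕ → ℕ → ℕ
ρ i n = nth1 (exps n) i

-- ladder with perfect trees hung on it, from the list of exponents in
-- DEcreasing order [ρ_ω, ..., ρ_1]: the first perfect tree is a child of the
-- root, ..., the last two are the children of the lowest internal node.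
ladder : List ℕ → Tree
ladder [] = leaf
ladder (r ∷ []) = perfect r
ladder (r ∷ s ∷ rs) = node (perfect r) (ladder (s ∷ rs))

descMinD : ℕ → Tree
descMinD n = ladder (reverse (exps n))

cdesc : ℕ → ℕ
cdesc n = colless (descMinD n)

-- The exponents of 2m are those of m shifted up by one, so the descending MinD tree of
-- 2m is that of m with every leaf replaced by a cherry, which doubles the Colless index.
-- The exponents of 2m + 1 are these shifted ones followed by 0, so its tree is the
-- doubled tree with one extra leaf at the bottom of the spine. At each of the ω(m) − 1
-- upper spine nodes the perfect side 2 · 2^ρ now faces 2L + 1 leaves instead of 2L,
-- and since L < 2^ρ (the exponents decrease down the spine) the imbalance is one less
-- than twice the old one; the new lowest node has imbalance 2^(ρ₁ + 1) − 1.
module Submission where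

open import Defs
open import Data.Nat
  using (ℕ; zero; suc; _+_; _*_; _∸_; _^_; _≥_; _≤_; _<_; _>_; ∣_-_∣; _/_; _%_; _≟_; z≤n; s≤s; s≤s⁻¹)
open import Data.Nat.Properties
open import Data.Nat.DivMod
open import Data.Nat.Tactic.RingSolver using (solve-∀)
open import Data.Integer using (+_; _-_) renaming (_+_ to _+ℤ_)
import Data.Integer.Properties as ℤ
import Data.Integer.Tactic.RingSolver as ℤ-Solver
open import Data.List using ([]; _∷_; _∷ʳ_; _ʳ++_; map; reverse; length)
open import Data.List.Properties using (unfold-reverse; reverse-map; length-reverse)
open import Data.List.Relation.Unary.All as All using (All; []; _∷_)
open import Data.List.Relation.Unary.AllPairs using (AllPairs; []; _∷_)
open import Data.List.Relation.Unary.Linked using (Linked; []; [-]; _∷_)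
open import Data.List.Relation.Unary.Linked.Properties using (AllPairs⇒Linked)
open import Data.Product using (_×_; _,_; proj₂; ∃₂)
open import Function using (flip; case_of_)
open import Relation.Binary.Core using (Rel)
open import Relation.Binary.PropositionalEquality
open import Relation.Nullary using (yes; no; contradiction)

module _ {a ℓ} {A : Set a} {R : Rel A ℓ} where

  ʳ++⁺ : ∀ {x xs acc} → Linked R (x ∷ xs) → Linked (flip R) (x ∷ acc) →
         Linked (flip R) (xs ʳ++ x ∷ acc)
  ʳ++⁺ [-]       ↙ = ↙
  ʳ++⁺ (Rxy ∷ ↗) ↙ = ʳ++⁺ ↗ (Rxy ∷ ↙)

  reverse⁺ : ∀ {xs} → Linked R xs → Linked (flip R) (reverse xs)
  reverse⁺ []        = []
  reverse⁺ [-]       = [-]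
  reverse⁺ (Rxy ∷ ↗) = ʳ++⁺ ↗ (Rxy ∷ [-])

expsAux-zero : ∀ f k → expsAux f k 0 ≡ []
expsAux-zero zero    k = refl
expsAux-zero (suc f) k = refl

expsAux-shift : ∀ f k n → expsAux f (suc k) n ≡ map suc (expsAux f k n)
expsAux-shift zero    k n = refl
expsAux-shift (suc f) k n with n ≟ 0
... | yes _ = refl
... | no _ with n % 2 ≟ 1
...   | yes _ = cong (suc k ∷_) (expsAux-shift f (suc k) (n / 2))
...   | no _  = expsAux-shift f (suc k) (n / 2)

n≤1+f⇒n/2≤f : ∀ {n f} → n ≤ suc f → n / 2 ≤ f
n≤1+f⇒n/2≤f {zero}      _     = z≤n
n≤1+f⇒n/2≤f {n@(suc _)} n≤1+f = s≤s⁻¹ (≤-trans (m/n<m n 2 (s≤s (s≤s z≤n))) n≤1+f)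

expsAux-fuel : ∀ f g k n → n ≤ f → n ≤ g → expsAux f k n ≡ expsAux g k n
expsAux-fuel zero    zero    k n     _   _   = refl
expsAux-fuel zero    (suc g) k .zero z≤n _   = sym (expsAux-zero (suc g) k)
expsAux-fuel (suc f) zero    k .zero _   z≤n = expsAux-zero (suc f) k
expsAux-fuel (suc f) (suc g) k n n≤f n≤g with n ≟ 0
... | yes _ = refl
... | no _ with n % 2 ≟ 1
...   | yes _ = cong (k ∷_) (expsAux-fuel f g (suc k) (n / 2) (n≤1+f⇒n/2≤f n≤f) (n≤1+f⇒n/2≤f n≤g))
...   | no _  = expsAux-fuel f g (suc k) (n / 2) (n≤1+f⇒n/2≤f n≤f) (n≤1+f⇒n/2≤f n≤g)

expsAux-unfold-even : ∀ f k n → n % 2 ≢ 1 → expsAux (suc f) k n ≡ expsAux f (suc k) (n / 2)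
expsAux-unfold-even f k n even with n ≟ 0
... | yes refl = sym (expsAux-zero f (suc k))
... | no _ with n % 2 ≟ 1
...   | yes odd = contradiction odd even
...   | no _    = refl

expsAux-unfold-odd : ∀ f k n → n % 2 ≡ 1 → expsAux (suc f) k n ≡ k ∷ expsAux f (suc k) (n / 2)
expsAux-unfold-odd f k n odd with n ≟ 0
... | yes refl = case odd of λ ()
... | no _ with n % 2 ≟ 1
...   | yes _    = refl
...   | no even = contradiction odd even

2*m%2≡0 : ∀ m → 2 * m % 2 ≡ 0
2*m%2≡0 m = trans (cong (_% 2) (*-comm 2 m)) (m*n%n≡0 m 2)

2*m/2≡m : ∀ m → 2 * m / 2 ≡ m
2*m/2≡m m = trans (cong (_/ 2) (*-comm 2 m)) (m*n/n≡m m 2)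

[1+2*m]%2≡1 : ∀ m → suc (2 * m) % 2 ≡ 1
[1+2*m]%2≡1 m = trans (cong (λ k → suc k % 2) (*-comm 2 m)) ([m+kn]%n≡m%n 1 m 2)

[1+2*m]/2≡m : ∀ m → suc (2 * m) / 2 ≡ m
[1+2*m]/2≡m m = begin
  suc (2 * m) / 2   ≡⟨ cong (λ k → suc k / 2) (*-comm 2 m) ⟩
  (1 + m * 2) / 2   ≡⟨ +-distrib-/ 1 (m * 2) (subst (λ r → 1 + r < 2) (sym (m*n%n≡0 m 2)) ≤-refl) ⟩
  m * 2 / 2         ≡⟨ m*n/n≡m m 2 ⟩
  m                 ∎
  where open ≡-Reasoning

expsAux-2m-1-m : ∀ m → expsAux (2 * m) 1 m ≡ map suc (exps m)
expsAux-2m-1-m m = trans (expsAux-fuel (2 * m) m 1 m (m≤n*m m 2) ≤-refl) (expsAux-shift m 0 m)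

exps-even : ∀ m → exps (2 * m) ≡ map suc (exps m)
exps-even m = begin
  exps (2 * m)                        ≡⟨ expsAux-fuel (2 * m) (suc (2 * m)) 0 (2 * m) ≤-refl (n≤1+n _) ⟩
  expsAux (suc (2 * m)) 0 (2 * m)     ≡⟨ expsAux-unfold-even (2 * m) 0 (2 * m) (λ odd → 0≢1+n (trans (sym (2*m%2≡0 m)) odd)) ⟩
  expsAux (2 * m) 1 (2 * m / 2)       ≡⟨ cong (expsAux (2 * m) 1) (2*m/2≡m m) ⟩
  expsAux (2 * m) 1 m                 ≡⟨ expsAux-2m-1-m m ⟩
  map suc (exps m)                    ∎
  where open ≡-Reasoning

exps-odd : ∀ m → exps (2 * m + 1) ≡ 0 ∷ map suc (exps m)
exps-odd m = begin
  exps (2 * m + 1)                    ≡⟨ cong exps (+-comm (2 * m) 1) ⟩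
  exps (suc (2 * m))                  ≡⟨ expsAux-unfold-odd (2 * m) 0 (suc (2 * m)) ([1+2*m]%2≡1 m) ⟩
  0 ∷ expsAux (2 * m) 1 (suc (2 * m) / 2) ≡⟨ cong (λ k → 0 ∷ expsAux (2 * m) 1 k) ([1+2*m]/2≡m m) ⟩
  0 ∷ expsAux (2 * m) 1 m             ≡⟨ cong (0 ∷_) (expsAux-2m-1-m m) ⟩
  0 ∷ map suc (exps m)                ∎
  where open ≡-Reasoning

half>0 : ∀ n → 0 < n → n % 2 ≢ 1 → 0 < n / 2
half>0 (suc zero)      _ even = contradiction refl even
half>0 n@(suc (suc _)) _ _  = m≥n⇒m/n>0 {n} (s≤s (s≤s z≤n))

expsAux-nonempty : ∀ f k n → 0 < n → n ≤ f → ∃₂ λ e es → expsAux f k n ≡ e ∷ es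
expsAux-nonempty zero    k n 0<n n≤0 = contradiction n≤0 (<⇒≱ 0<n)
expsAux-nonempty (suc f) k n 0<n n≤f with n % 2 ≟ 1
... | yes odd  = k , _ , expsAux-unfold-odd f k n odd
... | no  even with expsAux-nonempty f (suc k) (n / 2) (half>0 n 0<n even) (n≤1+f⇒n/2≤f {n} n≤f)
...   | e , es , eq = e , es , trans (expsAux-unfold-even f k n even) eq

exps-nonempty : ∀ {n} → n ≥ 1 → ∃₂ λ e es → exps n ≡ e ∷ es
exps-nonempty n≥1 = expsAux-nonempty _ 0 _ n≥1 ≤-refl

expsAux-≥ : ∀ f k n → All (k ≤_) (expsAux f k n)
expsAux-≥ zero    k n = []
expsAux-≥ (suc f) k n with n ≟ 0
... | yes _ = []
... | no _ with n % 2 ≟ 1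
...   | yes _ = ≤-refl ∷ All.map <⇒≤ (expsAux-≥ f (suc k) (n / 2))
...   | no _  = All.map <⇒≤ (expsAux-≥ f (suc k) (n / 2))

expsAux-strictlySorted : ∀ f k n → AllPairs _<_ (expsAux f k n)
expsAux-strictlySorted zero    k n = []
expsAux-strictlySorted (suc f) k n with n ≟ 0
... | yes _ = []
... | no _ with n % 2 ≟ 1
...   | yes _ = expsAux-≥ f (suc k) (n / 2) ∷ expsAux-strictlySorted f (suc k) (n / 2)
...   | no _  = expsAux-strictlySorted f (suc k) (n / 2)

reverse-exps-strictlyDecreasing : ∀ n → Linked _>_ (reverse (exps n))
reverse-exps-strictlyDecreasing n = reverse⁺ (AllPairs⇒Linked (expsAux-strictlySorted n 0 n))

double : Tree → Tree
double leaf       = node leaf leaf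
double (node l r) = node (double l) (double r)

leaves-double : ∀ t → leaves (double t) ≡ 2 * leaves t
leaves-double leaf       = refl
leaves-double (node l r) = begin
  leaves (double l) + leaves (double r) ≡⟨ cong₂ _+_ (leaves-double l) (leaves-double r) ⟩
  2 * leaves l + 2 * leaves r           ≡⟨ *-distribˡ-+ 2 (leaves l) (leaves r) ⟨
  2 * (leaves l + leaves r)             ∎
  where open ≡-Reasoning

colless-double : ∀ t → colless (double t) ≡ 2 * colless t
colless-double leaf       = refl
colless-double (node l r) = begin
  ∣ leaves (double l) - leaves (double r) ∣ + colless (double l) + colless (double r)
    ≡⟨ cong₂ _+_ (cong₂ _+_ (cong₂ ∣_-_∣ (leaves-double l) (leaves-double r)) (colless-double l))
                 (colless-double r) ⟩
  ∣ 2 * leaves l - 2 * leaves r ∣ + 2 * colless l + 2 * colless r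
    ≡⟨ cong (λ d → d + 2 * colless l + 2 * colless r) (*-distribˡ-∣-∣ 2 (leaves l) (leaves r)) ⟨
  2 * ∣ leaves l - leaves r ∣ + 2 * colless l + 2 * colless r
    ≡⟨ 2*-distrib₃ ∣ leaves l - leaves r ∣ (colless l) (colless r) ⟩
  2 * (∣ leaves l - leaves r ∣ + colless l + colless r)
    ∎
  where
  open ≡-Reasoning
  2*-distrib₃ : ∀ a b c → 2 * a + 2 * b + 2 * c ≡ 2 * (a + b + c)
  2*-distrib₃ = solve-∀

double-perfect : ∀ r → double (perfect r) ≡ perfect (suc r)
double-perfect zero    = refl
double-perfect (suc r) = cong₂ node (double-perfect r) (double-perfect r)

leaves-perfect : ∀ r → leaves (perfect r) ≡ 2 ^ r
leaves-perfect zero    = refl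
leaves-perfect (suc r) = begin
  leaves (perfect (suc r))    ≡⟨ cong leaves (double-perfect r) ⟨
  leaves (double (perfect r)) ≡⟨ leaves-double (perfect r) ⟩
  2 * leaves (perfect r)      ≡⟨ cong (2 *_) (leaves-perfect r) ⟩
  2 ^ suc r                   ∎
  where open ≡-Reasoning

colless-perfect : ∀ r → colless (perfect r) ≡ 0
colless-perfect zero    = refl
colless-perfect (suc r) = begin
  colless (perfect (suc r))    ≡⟨ cong colless (double-perfect r) ⟨
  colless (double (perfect r)) ≡⟨ colless-double (perfect r) ⟩
  2 * colless (perfect r)      ≡⟨ cong (2 *_) (colless-perfect r) ⟩
  0                            ∎
  where open ≡-Reasoning

ladder-map-suc : ∀ d ds → ladder (map suc (d ∷ ds)) ≡ double (ladder (d ∷ ds))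
ladder-map-suc d []        = sym (double-perfect d)
ladder-map-suc d (d′ ∷ ds) = cong₂ node (sym (double-perfect d)) (ladder-map-suc d′ ds)

colless-ladder-map-suc : ∀ ds → colless (ladder (map suc ds)) ≡ 2 * colless (ladder ds)
colless-ladder-map-suc []       = refl
colless-ladder-map-suc (d ∷ ds) = trans (cong colless (ladder-map-suc d ds)) (colless-double (ladder (d ∷ ds)))

leaves-ladder< : ∀ {b d ds} → d < b → Linked _>_ (d ∷ ds) → leaves (ladder (d ∷ ds)) < 2 ^ b
leaves-ladder< {b} {d} d<b [-] = begin-strict
  leaves (perfect d) ≡⟨ leaves-perfect d ⟩
  2 ^ d              <⟨ ^-monoʳ-< 2 ≤-refl d<b ⟩
  2 ^ b              ∎
  where open ≤-Reasoning
leaves-ladder< {b} {d} {d′ ∷ ds} d<b (d′<d ∷ ↘) = begin-strict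
  leaves (perfect d) + leaves (ladder (d′ ∷ ds)) <⟨ +-monoʳ-< (leaves (perfect d)) (leaves-ladder< d′<d ↘) ⟩
  leaves (perfect d) + 2 ^ d                     ≡⟨ cong (_+ 2 ^ d) (leaves-perfect d) ⟩
  2 ^ d + 2 ^ d                                  ≡⟨ cong (_+_ (2 ^ d)) (+-identityʳ (2 ^ d)) ⟨
  2 ^ suc d                                      ≤⟨ ^-monoʳ-≤ 2 d<b ⟩
  2 ^ b                                          ∎
  where open ≤-Reasoning

∣2m-[1+2n]∣+1≡2∣m-n∣ : ∀ {m n} → n < m → ∣ 2 * m - (1 + 2 * n) ∣ + 1 ≡ 2 * ∣ m - n ∣
∣2m-[1+2n]∣+1≡2∣m-n∣ {m} {n} n<m = begin
  ∣ 2 * m - suc (2 * n) ∣ + 1   ≡⟨ cong (_+ 1) (m≤n⇒∣n-m∣≡n∸m 2n<2m) ⟩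
  2 * m ∸ suc (2 * n) + 1       ≡⟨ +-comm _ 1 ⟩
  1 + (2 * m ∸ suc (2 * n))     ≡⟨ +-∸-assoc 1 2n<2m ⟨
  2 * m ∸ 2 * n                 ≡⟨ *-distribˡ-∸ 2 m n ⟨
  2 * (m ∸ n)                   ≡⟨ cong (2 *_) (m≤n⇒∣n-m∣≡n∸m (<⇒≤ n<m)) ⟨
  2 * ∣ m - n ∣                 ∎
  where
  open ≡-Reasoning
  2n<2m : 2 * n < 2 * m
  2n<2m = *-monoʳ-< 2 n<m

-- In use, R′ is R with its perfect trees doubled and one extra leaf hung at the bottom.
odd-step : ∀ d R R′ {k p} → leaves R < 2 ^ d →
  (leaves R′ ≡ 1 + 2 * leaves R) × (colless R′ + k ≡ 2 * colless R + p) →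
  (leaves (node (perfect (suc d)) R′) ≡ 1 + 2 * leaves (node (perfect d) R)) ×
  (colless (node (perfect (suc d)) R′) + suc k ≡ 2 * colless (node (perfect d) R) + p)
odd-step d R R′ {k} {p} R<2^d (leaves-R′ , colless-R′) = leaves-step , colless-step
  where
  open ≡-Reasoning
  Q = leaves (perfect d)
  L = leaves R
  leaves-step : Q + Q + leaves R′ ≡ 1 + 2 * (Q + L)
  leaves-step = trans (cong (_+_ (Q + Q)) leaves-R′) (rearrange Q L)
    where
    rearrange : ∀ Q L → Q + Q + (1 + 2 * L) ≡ 1 + 2 * (Q + L)
    rearrange = solve-∀
  colless-step : ∣ Q + Q - leaves R′ ∣ + colless (perfect (suc d)) + colless R′ + suc k
               ≡ 2 * (∣ Q - L ∣ + colless (perfect d) + colless R) + p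
  colless-step = begin
    ∣ Q + Q - leaves R′ ∣ + colless (perfect (suc d)) + colless R′ + suc k
      ≡⟨ cong₂ (λ q c → ∣ q - leaves R′ ∣ + c + colless R′ + suc k)
               (leaves-perfect (suc d)) (colless-perfect (suc d)) ⟩
    ∣ 2 ^ suc d - leaves R′ ∣ + 0 + colless R′ + suc k
      ≡⟨ cong (λ l → ∣ 2 ^ suc d - l ∣ + 0 + colless R′ + suc k) leaves-R′ ⟩
    ∣ 2 * 2 ^ d - (1 + 2 * L) ∣ + 0 + colless R′ + suc k
      ≡⟨ regroup ∣ 2 * 2 ^ d - (1 + 2 * L) ∣ (colless R′) k ⟩
    (∣ 2 * 2 ^ d - (1 + 2 * L) ∣ + 1) + (colless R′ + k)
      ≡⟨ cong₂ _+_ (∣2m-[1+2n]∣+1≡2∣m-n∣ R<2^d) colless-R′ ⟩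
    2 * ∣ 2 ^ d - L ∣ + (2 * colless R + p)
      ≡⟨ regroup′ ∣ 2 ^ d - L ∣ (colless R) p ⟩
    2 * (∣ 2 ^ d - L ∣ + 0 + colless R) + p
      ≡⟨ cong₂ (λ q c → 2 * (∣ q - L ∣ + c + colless R) + p) (leaves-perfect d) (colless-perfect d) ⟨
    2 * (∣ Q - L ∣ + colless (perfect d) + colless R) + p
      ∎
    where
    regroup : ∀ a c k → a + 0 + c + suc k ≡ (a + 1) + (c + k)
    regroup = solve-∀
    regroup′ : ∀ a c p → 2 * a + (2 * c + p) ≡ 2 * (a + 0 + c) + p
    regroup′ = solve-∀

ladder-odd : ∀ ds e → Linked _>_ (ds ∷ʳ e) →
  (leaves (ladder (map suc (ds ∷ʳ e) ∷ʳ 0)) ≡ 1 + 2 * leaves (ladder (ds ∷ʳ e))) ×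
  (colless (ladder (map suc (ds ∷ʳ e) ∷ʳ 0)) + length (ds ∷ʳ e)
     ≡ 2 * colless (ladder (ds ∷ʳ e)) + 2 ^ suc e)
ladder-odd []            e _           = rearrange (leaves (perfect e)) , colless-lowest
  where
  open ≡-Reasoning
  rearrange : ∀ Q → Q + Q + 1 ≡ 1 + 2 * Q
  rearrange = solve-∀
  colless-lowest : ∣ leaves (perfect (suc e)) - 1 ∣ + colless (perfect (suc e)) + 0 + 1
                 ≡ 2 * colless (perfect e) + 2 ^ suc e
  colless-lowest = begin
    ∣ leaves (perfect (suc e)) - 1 ∣ + colless (perfect (suc e)) + 0 + 1
      ≡⟨ cong₂ (λ q c → ∣ q - 1 ∣ + c + 0 + 1) (leaves-perfect (suc e)) (colless-perfect (suc e)) ⟩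
    ∣ 2 * 2 ^ e - 1 ∣ + 0 + 0 + 1
      ≡⟨ cong (_+ 1) (trans (+-identityʳ _) (+-identityʳ _)) ⟩
    ∣ 2 * 2 ^ e - (1 + 2 * 0) ∣ + 1
      ≡⟨ ∣2m-[1+2n]∣+1≡2∣m-n∣ (m^n>0 2 e) ⟩
    2 * ∣ 2 ^ e - 0 ∣
      ≡⟨ cong (2 *_) (∣-∣-identityʳ (2 ^ e)) ⟩
    2 ^ suc e
      ≡⟨ cong (λ c → 2 * c + 2 ^ suc e) (colless-perfect e) ⟨
    2 * colless (perfect e) + 2 ^ suc e
      ∎
ladder-odd (d ∷ [])      e (e<d ∷ [-]) =
  odd-step d (perfect e) (node (perfect (suc e)) leaf) (leaves-ladder< e<d [-]) (ladder-odd [] e [-])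
ladder-odd (d ∷ d′ ∷ ds) e (d′<d ∷ ↘) =
  odd-step d (ladder ((d′ ∷ ds) ∷ʳ e)) (ladder (map suc ((d′ ∷ ds) ∷ʳ e) ∷ʳ 0))
           (leaves-ladder< d′<d ↘) (ladder-odd (d′ ∷ ds) e ↘)

cdesc-double : ∀ m → cdesc (2 * m) ≡ 2 * cdesc m
cdesc-double m = begin
  colless (ladder (reverse (exps (2 * m))))     ≡⟨ cong (λ xs → colless (ladder (reverse xs))) (exps-even m) ⟩
  colless (ladder (reverse (map suc (exps m)))) ≡⟨ cong (λ xs → colless (ladder xs)) (reverse-map suc (exps m)) ⟨
  colless (ladder (map suc (reverse (exps m)))) ≡⟨ colless-ladder-map-suc (reverse (exps m)) ⟩
  2 * cdesc m                                   ∎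
  where open ≡-Reasoning

reverse-exps-odd : ∀ m → reverse (exps (2 * m + 1)) ≡ map suc (reverse (exps m)) ∷ʳ 0
reverse-exps-odd m = begin
  reverse (exps (2 * m + 1))      ≡⟨ cong reverse (exps-odd m) ⟩
  reverse (0 ∷ map suc (exps m))  ≡⟨ unfold-reverse 0 (map suc (exps m)) ⟩
  reverse (map suc (exps m)) ∷ʳ 0 ≡⟨ cong (_∷ʳ 0) (reverse-map suc (exps m)) ⟨
  map suc (reverse (exps m)) ∷ʳ 0 ∎
  where open ≡-Reasoning

ρ₂-odd : ∀ m {e es} → exps m ≡ e ∷ es → ρ 2 (2 * m + 1) ≡ suc e
ρ₂-odd m exps-m = cong (λ xs → nth1 xs 2) (trans (exps-odd m) (cong (λ xs → 0 ∷ map suc xs) exps-m))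

cdesc-odd : ∀ m → m ≥ 1 → cdesc (2 * m + 1) + ω m ≡ 2 * cdesc m + 2 ^ ρ 2 (2 * m + 1)
cdesc-odd m m≥1 with e , es , exps-m ← exps-nonempty m≥1 = begin
  colless (ladder (reverse (exps (2 * m + 1)))) + length (exps m)
    ≡⟨ cong₂ (λ xs n → colless (ladder xs) + n) (reverse-exps-odd m) (sym (length-reverse (exps m))) ⟩
  colless (ladder (map suc (reverse (exps m)) ∷ʳ 0)) + length (reverse (exps m))
    ≡⟨ cong (λ xs → colless (ladder (map suc xs ∷ʳ 0)) + length xs) reverse-exps-m ⟩
  colless (ladder (map suc (reverse es ∷ʳ e) ∷ʳ 0)) + length (reverse es ∷ʳ e)
    ≡⟨ proj₂ (ladder-odd (reverse es) e decreasing) ⟩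
  2 * colless (ladder (reverse es ∷ʳ e)) + 2 ^ suc e
    ≡⟨ cong₂ (λ xs r → 2 * colless (ladder xs) + 2 ^ r) reverse-exps-m (ρ₂-odd m exps-m) ⟨
  2 * cdesc m + 2 ^ ρ 2 (2 * m + 1)
    ∎
  where
  open ≡-Reasoning
  reverse-exps-m : reverse (exps m) ≡ reverse es ∷ʳ e
  reverse-exps-m = trans (cong reverse exps-m) (unfold-reverse e es)
  decreasing : Linked _>_ (reverse es ∷ʳ e)
  decreasing = subst (Linked _>_) reverse-exps-m (reverse-exps-strictlyDecreasing m)

m+k≡n+p⇒+m≡+n-+k+p : ∀ {m k n p} → m + k ≡ n + p → + m ≡ (+ n - + k) +ℤ + p
m+k≡n+p⇒+m≡+n-+k+p {m} {k} {n} {p} eq = begin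
  + m                ≡⟨ add-sub (+ m) (+ k) ⟩
  (+ m +ℤ + k) - + k ≡⟨ cong (λ x → x - + k) (ℤ.pos-+ m k) ⟨
  + (m + k) - + k    ≡⟨ cong (λ x → + x - + k) eq ⟩
  + (n + p) - + k    ≡⟨ cong (λ x → x - + k) (ℤ.pos-+ n p) ⟩
  (+ n +ℤ + p) - + k ≡⟨ sub-comm (+ n) (+ p) (+ k) ⟩
  (+ n - + k) +ℤ + p ∎
  where
  open ≡-Reasoning
  add-sub : ∀ x y → x ≡ (x +ℤ y) - y
  add-sub = ℤ-Solver.solve-∀
  sub-comm : ∀ x y z → (x +ℤ y) - z ≡ (x - z) +ℤ y
  sub-comm = ℤ-Solver.solve-∀

theorem93 : (m : ℕ) → m ≥ 1 →
    (cdesc (2 * m) ≡ 2 * cdesc m) ×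
    (+ cdesc (2 * m + 1) ≡ (+ (2 * cdesc m) - + ω m) +ℤ + (2 ^ ρ 2 (2 * m + 1)))
theorem93 m m≥1 = cdesc-double m , m+k≡n+p⇒+m≡+n-+k+p (cdesc-odd m m≥1)
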